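{- Write $f(k,m,n)=f_{\text{2--1--2'}}(k,m,n)$. Then for all $n\ge3$: (i) $f(1,m,n)=2^{n-m-2}$ for $1\le m\le n-3$; (ii) $f(1,n-1,n)=2$; (iii) $f(1,n,n)=f(1,n-2,n)=0$.
   Context: The standard cycle form of $\pi\in\mathcal S_n$ writes each cycle starting with its smallest element, cycles listed in decreasing order of smallest elements; $\Psi(\pi)$ is the word obtained by deleting the parentheses. A cyclic occurrence of 2--1--2' in $\pi$ is a triple of indices $i<j<k$ with $w_j<w_i$ and $w_j<w_k$, where $w=\Psi(\pi)$. $f_{\text{2--1--2'}}(k,m,n)$ is the number of $\pi\in\mathcal S_n$ with $m$ cycles and exactly $k$ cyclic occurrences of 2--1--2'. -}

module Defs where

open import Data.Bool using (Bool; true; false; if_then_else_; _∧_; not)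
open import Data.Nat using (ℕ; zero; suc; _+_; _<ᵇ_; _≡ᵇ_)
open import Data.Fin using (Fin; toℕ)
open import Data.List using (List; []; _∷_; _++_; map; concatMap; filterᵇ; length; allFin; reverse; foldr)
open import Data.Vec using (Vec; lookup) renaming ([] to []ᵥ; _∷_ to _∷ᵥ_; toList to vtoList)

-- Permutations of {0,…,n-1} in one-line notation: a vector v with v[i] = π(i).
-- (Values 0..n-1 instead of 1..n; pattern counts and cycle counts are unaffected.)

allVecs : (n k : ℕ) → List (Vec (Fin n) k)
allVecs n zero = []ᵥ ∷ []
allVecs n (suc k) = concatMap (λ x → map (x ∷ᵥ_) (allVecs n k)) (allFin n)

elemᵇ : ℕ → List ℕ → Bool
elemᵇ x [] = false
elemᵇ x (y ∷ ys) = if x ≡ᵇ y then true else elemᵇ x ys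

noDupᵇ : List ℕ → Bool
noDupᵇ [] = true
noDupᵇ (x ∷ xs) = not (elemᵇ x xs) ∧ noDupᵇ xs

perms : (n : ℕ) → List (Vec (Fin n) n)
perms n = filterᵇ (λ v → noDupᵇ (map toℕ (vtoList v))) (allVecs n n)

-- the cycle of π through i, listed starting at i: i, π i, π² i, …
-- (fuel n suffices since every cycle has length ≤ n)
orbitGo : {n : ℕ} → Vec (Fin n) n → ℕ → ℕ → Fin n → List ℕ
orbitGo π zero start j = []
orbitGo π (suc fuel) start j =
  toℕ j ∷ (if toℕ (lookup π j) ≡ᵇ start then [] else orbitGo π fuel start (lookup π j))

orbit : {n : ℕ} → Vec (Fin n) n → Fin n → List ℕ
orbit {n} π i = orbitGo π n (toℕ i) i

allGeᵇ : ℕ → List ℕ → Bool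
allGeᵇ x [] = true
allGeᵇ x (y ∷ ys) = not (y <ᵇ x) ∧ allGeᵇ x ys

isCycleMin : {n : ℕ} → Vec (Fin n) n → Fin n → Bool
isCycleMin π i = allGeᵇ (toℕ i) (orbit π i)

cycleMins : {n : ℕ} → Vec (Fin n) n → List (Fin n)
cycleMins {n} π = reverse (filterᵇ (isCycleMin π) (allFin n))

standardCycleForm : {n : ℕ} → Vec (Fin n) n → List (List ℕ)
standardCycleForm π = map (orbit π) (cycleMins π)

numCycles : {n : ℕ} → Vec (Fin n) n → ℕ
numCycles π = length (standardCycleForm π)

Ψ : {n : ℕ} → Vec (Fin n) n → List ℕ
Ψ π = foldr _++_ [] (standardCycleForm π)

countGt : ℕ → List ℕ → ℕ
countGt y [] = 0
countGt y (z ∷ zs) = (if y <ᵇ z then 1 else 0) + countGt y zs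

pairs212 : ℕ → List ℕ → ℕ
pairs212 x [] = 0
pairs212 x (y ∷ ys) = (if y <ᵇ x then countGt y ys else 0) + pairs212 x ys

-- number of triples i<j<k of positions with w_j < w_i and w_j < w_k
occ212 : List ℕ → ℕ
occ212 [] = 0
occ212 (x ∷ xs) = pairs212 x xs + occ212 xs

cyclicOcc212 : {n : ℕ} → Vec (Fin n) n → ℕ
cyclicOcc212 π = occ212 (Ψ π)

f : ℕ → ℕ → ℕ → ℕ
f k m n = length (filterᵇ (λ π → (numCycles π ≡ᵇ m) ∧ (cyclicOcc212 π ≡ᵇ k)) (perms n))

-- Ψ is a bijection from S_n onto the words that list 0,…,n-1 once each, and the cycles of π
-- are the blocks of Ψ π cut before each left-to-right minimum, so f(k,m,n) counts words with
-- k occurrences of 2-1-2′ and m left-to-right minima. Every word of length n+1 arises exactly once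
-- by raising the letters of a word of length n and inserting a new letter 0. Inserted after a
-- prefix of length a and before a suffix of length b, the 0 is the middle letter of a·b new
-- occurrences, which is at least 2 unless the 0 goes to the front or to the end (for n ≥ 3).
-- Inserting at the front gives one left-to-right minimum, at the end one more than before, so
-- f(1,1,n+1) = Σ_m f(1,m,n), f(1,m+1,n+1) = f(1,m,n) and Σ_m f(1,m,n+1) = 2 Σ_m f(1,m,n),
-- which with the values at n = 3 gives the formulas.

module Submission where

open import Defs
open import Data.Nat using (ℕ; zero; suc; _+_; _*_; _∸_; _^_; _≤_; _<_; z≤n; s≤s; pred; _<ᵇ_; _≡ᵇ_)
open import Data.Nat.Properties
  using (_≟_; ≤-refl; ≤-trans; ≤-antisym; <-trans; <-irrefl; ≤∧≢⇒<; n≢0⇒n>0; ≮⇒≥; <-≤-trans; m≤m+n; m≤n+m;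
         +-identityʳ; +-suc; +-comm; _<?_; +-assoc; *-zeroʳ; suc-injective; ≡ᵇ⇒≡; <ᵇ⇒<; <⇒<ᵇ; m≤n⇒m≤1+n; ≤-pred)
open import Data.Nat.Solver using (module +-*-Solver)
open import Data.Bool using (Bool; true; false; if_then_else_; _∧_; not; T)
open import Data.Bool.Properties using (∧-zeroʳ; T-≡)
open import Data.Unit using (tt)
open import Data.Empty using (⊥; ⊥-elim)
open import Data.Product using (∃; _×_; _,_; proj₁; proj₂)
open import Data.Fin using (Fin; toℕ; fromℕ<) renaming (zero to fzero; suc to fsuc)
import Data.Fin.Properties as Fin
open import Data.Vec using (Vec; lookup; tabulate) renaming ([] to []ᵥ; _∷_ to _∷ᵥ_; toList to vtoList)
import Data.Vec.Properties as Vec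
open import Data.List
  using (List; []; _∷_; _++_; _∷ʳ_; map; length; concat; concatMap; filterᵇ; reverse; allFin; upTo; applyUpTo)
open import Data.List.Properties
  using (length-map; length-++; ++-assoc; ++-identityʳ; map-∘; map-cong; filter-++;
         reverse-map; ∷-injectiveˡ; ∷-injectiveʳ; length-upTo; upTo-∷ʳ; map-concatMap; reverse-++)
import Data.List.Properties as List
open import Data.List.Membership.Propositional using (_∈_; _∉_; find; lose)
open import Data.List.Membership.Propositional.Properties
  using (∈-map⁺; ∈-map⁻; ∈-concat⁺′; ∈-concat⁻′; ∈-concatMap⁺; ∈-concatMap⁻; ∈-∃++;
         ∈-filter⁺; ∈-filter⁻; ∈-allFin; ∈-upTo⁺)
open import Data.List.Relation.Binary.Subset.Propositional using (_⊆_)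
open import Data.List.Relation.Unary.Any using (Any; here; there)
open import Data.List.Relation.Unary.All using (All; []; _∷_)
import Data.List.Relation.Unary.All as All
import Data.List.Relation.Unary.All.Properties as All
open import Data.List.Relation.Unary.AllPairs using (AllPairs; []; _∷_)
import Data.List.Relation.Unary.AllPairs as AllPairs
open import Data.List.Relation.Unary.Unique.Propositional using (Unique)
import Data.List.Relation.Unary.Unique.Propositional.Properties as Unique
open import Data.List.Relation.Binary.Permutation.Propositional using (_↭_; ↭-sym; ↭⇒↭ₛ)
import Data.List.Relation.Binary.Permutation.Propositional as ↭
open import Data.List.Relation.Binary.Permutation.Propositional.Properties
  using (↭-length; ∈-resp-↭; All-resp-↭; shift; shifts; ++-comm)
import Data.List.Relation.Binary.Permutation.Propositional.Properties as ↭
open import Data.List.Relation.Binary.Permutation.Setoid.Properties using (Unique-resp-↭)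
import Data.List.Membership.DecPropositional as DecMembership
open import Relation.Nullary using (yes; no)
open import Relation.Nullary.Decidable using (T?)
open import Relation.Binary.Definitions using (DecidableEquality)
open import Relation.Binary.PropositionalEquality
  using (_≡_; _≢_; refl; sym; trans; cong; cong₂; subst; subst₂; setoid; module ≡-Reasoning)
open import Function using (_∘_; id; Equivalence)

∈-++-∷⁻ : {A : Set} (pre : List A) {x z : A} {suf : List A} → z ∈ pre ++ x ∷ suf → z ≢ x → z ∈ pre ++ suf
∈-++-∷⁻ pre {x} {suf = suf} z∈ z≢x with ∈-resp-↭ (shift x pre suf) z∈
... | here z≡x = ⊥-elim (z≢x z≡x)
... | there z∈′ = z∈′

length-⊆ : {A : Set} {xs ys : List A} → Unique xs → xs ⊆ ys → length xs ≤ length ys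
length-⊆ {xs = []} _ _ = z≤n
length-⊆ {xs = x ∷ xs} (x∉xs ∷ u) xs⊆ys with ∈-∃++ (xs⊆ys (here refl))
... | pre , suf , refl =
  subst (suc (length xs) ≤_) (sym (↭-length (shift x pre suf)))
    (s≤s (length-⊆ u (λ z∈ → ∈-++-∷⁻ pre (xs⊆ys (there z∈)) (λ z≡x → All.lookup x∉xs z∈ (sym z≡x)))))

⊆-by-length : {A : Set} → DecidableEquality A → {xs ys : List A} →
  Unique xs → xs ⊆ ys → length ys ≤ length xs → ys ⊆ xs
⊆-by-length _≟ᴬ_ {xs} u xs⊆ys ys≤xs {y} y∈ys with DecMembership._∈?_ _≟ᴬ_ y xs
... | yes y∈xs = y∈xs
... | no y∉xs with ∈-∃++ y∈ys
...   | pre , suf , refl = ⊥-elim (<-irrefl refl (<-≤-trans shorter ys≤xs))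
  where
  shorter : length xs < length (pre ++ y ∷ suf)
  shorter = subst (length xs <_) (sym (↭-length (shift y pre suf)))
    (s≤s (length-⊆ u (λ z∈ → ∈-++-∷⁻ pre (xs⊆ys z∈) (λ z≡y → y∉xs (subst (_∈ xs) z≡y z∈)))))

Unique-++⁻ : {A : Set} (xs : List A) {ys : List A} → Unique (xs ++ ys) →
  Unique xs × Unique ys × (∀ {z} → z ∈ xs → z ∉ ys)
Unique-++⁻ [] u = [] , u , λ ()
Unique-++⁻ (x ∷ xs) (x∉ ∷ u) with Unique-++⁻ xs u
... | uxs , uys , disjoint = All.++⁻ˡ xs x∉ ∷ uxs , uys , disjoint′
  where
  disjoint′ : ∀ {z} → z ∈ x ∷ xs → z ∉ _
  disjoint′ (here refl) z∈ys = All.lookup (All.++⁻ʳ xs x∉) z∈ys refl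
  disjoint′ (there z∈xs) z∈ys = disjoint z∈xs z∈ys

Unique-concat⁻ : {A : Set} {xss : List (List A)} {xs : List A} → Unique (concat xss) → xs ∈ xss → Unique xs
Unique-concat⁻ {xss = xs ∷ _} u (here refl) = proj₁ (Unique-++⁻ xs u)
Unique-concat⁻ {xss = ys ∷ _} u (there xs∈) = Unique-concat⁻ (proj₁ (proj₂ (Unique-++⁻ ys u))) xs∈

indicator : Bool → ℕ
indicator b = if b then 1 else 0

count : {A : Set} → (A → Bool) → List A → ℕ
count p [] = 0
count p (x ∷ xs) = indicator (p x) + count p xs

length-filterᵇ : {A : Set} (p : A → Bool) (xs : List A) → length (filterᵇ p xs) ≡ count p xs
length-filterᵇ p [] = refl
length-filterᵇ p (x ∷ xs) with p x
... | true = cong suc (length-filterᵇ p xs)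
... | false = length-filterᵇ p xs

count-map : {A B : Set} (p : B → Bool) (g : A → B) (xs : List A) → count p (map g xs) ≡ count (p ∘ g) xs
count-map p g [] = refl
count-map p g (x ∷ xs) = cong (indicator (p (g x)) +_) (count-map p g xs)

count-cong : {A : Set} {p q : A → Bool} (xs : List A) → (∀ {x} → x ∈ xs → p x ≡ q x) → count p xs ≡ count q xs
count-cong [] _ = refl
count-cong (x ∷ xs) p≡q = cong₂ _+_ (cong indicator (p≡q (here refl))) (count-cong xs (p≡q ∘ there))

count-++ : {A : Set} (p : A → Bool) (xs ys : List A) → count p (xs ++ ys) ≡ count p xs + count p ys
count-++ p [] ys = refl
count-++ p (x ∷ xs) ys = trans (cong (indicator (p x) +_) (count-++ p xs ys)) (sym (+-assoc (indicator (p x)) _ _))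

count-false : {A : Set} (xs : List A) → count (λ _ → false) xs ≡ 0
count-false [] = refl
count-false (x ∷ xs) = count-false xs

count-mono : {A : Set} (p : A → Bool) {xs ys : List A} → Unique xs → xs ⊆ ys → count p xs ≤ count p ys
count-mono p {xs} {ys} u xs⊆ys = subst₂ _≤_ (length-filterᵇ p xs) (length-filterᵇ p ys)
  (length-⊆ (Unique.filter⁺ (T? ∘ p) u)
    (λ z∈ → let z∈xs , pz = ∈-filter⁻ (T? ∘ p) z∈ in ∈-filter⁺ (T? ∘ p) (xs⊆ys z∈xs) pz))

count-≡ : {A : Set} (p : A → Bool) {xs ys : List A} → Unique xs → Unique ys → xs ⊆ ys → ys ⊆ xs →
  count p xs ≡ count p ys
count-≡ p ux uy xs⊆ys ys⊆xs = ≤-antisym (count-mono p ux xs⊆ys) (count-mono p uy ys⊆xs)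

count-concatMap-split : {A B : Set} (g : A → List B) (P : B → Bool) (P₁ P₂ : A → Bool) (xs : List A) →
  (∀ {x} → x ∈ xs → count P (g x) ≡ indicator (P₁ x) + indicator (P₂ x)) →
  count P (concatMap g xs) ≡ count P₁ xs + count P₂ xs
count-concatMap-split g P P₁ P₂ [] _ = refl
count-concatMap-split g P P₁ P₂ (x ∷ xs) split =
  trans (count-++ P (g x) (concatMap g xs))
    (trans (cong₂ _+_ (split (here refl)) (count-concatMap-split g P P₁ P₂ xs (split ∘ there)))
      (solve 4 (λ a b c d → (a :+ b) :+ (c :+ d) := (a :+ c) :+ (b :+ d)) refl
        (indicator (P₁ x)) (indicator (P₂ x)) (count P₁ xs) (count P₂ xs)))
  where open +-*-Solver

concatMap-unique : {A B : Set} (g : A → List B) (g⁻¹ : B → A) {xs : List A} →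
  (∀ {a z} → z ∈ g a → g⁻¹ z ≡ a) → (∀ {a} → a ∈ xs → Unique (g a)) → Unique xs → Unique (concatMap g xs)
concatMap-unique g g⁻¹ {[]} _ _ _ = []
concatMap-unique g g⁻¹ {x ∷ xs} left ug (x∉xs ∷ u) =
  Unique.++⁺ (ug (here refl)) (concatMap-unique g g⁻¹ left (ug ∘ there) u) disjoint
  where
  disjoint : ∀ {z} → z ∈ g x × z ∈ concatMap g xs → ⊥
  disjoint (z∈gx , z∈rest) = go (∈-concatMap⁻ g {xs = xs} z∈rest) x∉xs
    where
    go : ∀ {ys} → Any (λ y → _ ∈ g y) ys → All (x ≢_) ys → ⊥
    go (here z∈gy) (x≢y ∷ _) = x≢y (trans (sym (left z∈gx)) (left z∈gy))
    go (there z∈) (_ ∷ x∉) = go z∈ x∉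

-- Permutation words

inserts : {A : Set} → A → List A → List (List A)
inserts x [] = (x ∷ []) ∷ []
inserts x (y ∷ ys) = (x ∷ y ∷ ys) ∷ map (y ∷_) (inserts x ys)

inserts-↭ : {A : Set} (x : A) (ys : List A) {zs : List A} → zs ∈ inserts x ys → zs ↭ x ∷ ys
inserts-↭ x [] (here refl) = ↭.refl
inserts-↭ x (y ∷ ys) (here refl) = ↭.refl
inserts-↭ x (y ∷ ys) (there zs∈) with ∈-map⁻ (y ∷_) zs∈
... | _ , zs′∈ , refl = ↭.trans (↭.prep y (inserts-↭ x ys zs′∈)) (↭.swap y x ↭.refl)

∈-inserts : {A : Set} (x : A) (pre suf : List A) → pre ++ x ∷ suf ∈ inserts x (pre ++ suf)
∈-inserts x [] [] = here refl
∈-inserts x [] (y ∷ suf) = here refl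
∈-inserts x (p ∷ pre) suf = there (∈-map⁺ (p ∷_) (∈-inserts x pre suf))

inserts-unique : {A : Set} (x : A) (ys : List A) → All (x ≢_) ys → Unique (inserts x ys)
inserts-unique x [] _ = [] ∷ []
inserts-unique x (y ∷ ys) (x≢y ∷ x∉ys) =
  All.tabulate (λ zs∈ eq → x≢y (head-eq eq zs∈)) ∷ Unique.map⁺ ∷-injectiveʳ (inserts-unique x ys x∉ys)
  where
  head-eq : ∀ {zs} → x ∷ y ∷ ys ≡ zs → zs ∈ map (y ∷_) (inserts x ys) → x ≡ y
  head-eq eq zs∈ with ∈-map⁻ (y ∷_) zs∈
  head-eq refl _ | _ , _ , refl = refl

permWords : ℕ → List (List ℕ)
permWords zero = [] ∷ []
permWords (suc n) = concatMap (inserts 0 ∘ map suc) (permWords n)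

IsPermWord : ℕ → List ℕ → Set
IsPermWord n w = Unique w × All (_< n) w × length w ≡ n

Positive : List ℕ → Set
Positive = All (0 <_)

map-suc-positive : (w : List ℕ) → Positive (map suc w)
map-suc-positive [] = []
map-suc-positive (x ∷ w) = s≤s z≤n ∷ map-suc-positive w

unshift : List ℕ → List ℕ
unshift [] = []
unshift (zero ∷ xs) = unshift xs
unshift (suc a ∷ xs) = a ∷ unshift xs

unshift-map-suc : (w : List ℕ) → unshift (map suc w) ≡ w
unshift-map-suc [] = refl
unshift-map-suc (x ∷ w) = cong (x ∷_) (unshift-map-suc w)

unshift-inserts : (ws : List ℕ) {zs : List ℕ} → zs ∈ inserts 0 ws → unshift zs ≡ unshift ws
unshift-inserts [] (here refl) = refl
unshift-inserts (y ∷ ys) (here refl) = refl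
unshift-inserts (y ∷ ys) (there zs∈) with ∈-map⁻ (y ∷_) zs∈
unshift-inserts (zero ∷ ys) (there _) | _ , zs′∈ , refl = unshift-inserts ys zs′∈
unshift-inserts (suc a ∷ ys) (there _) | _ , zs′∈ , refl = cong (a ∷_) (unshift-inserts ys zs′∈)

permWords-unique : (n : ℕ) → Unique (permWords n)
permWords-unique zero = [] ∷ []
permWords-unique (suc n) = concatMap-unique (inserts 0 ∘ map suc) unshift
  (λ {w} zs∈ → trans (unshift-inserts (map suc w) zs∈) (unshift-map-suc w))
  (λ {w} _ → inserts-unique 0 (map suc w) (All.map (λ 0<y 0≡y → <-irrefl 0≡y 0<y) (map-suc-positive w)))
  (permWords-unique n)

IsPermWord-resp-↭ : (n : ℕ) {xs ys : List ℕ} → xs ↭ ys → IsPermWord n xs → IsPermWord n ys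
IsPermWord-resp-↭ n p (u , bound , len) =
  Unique-resp-↭ (setoid ℕ) (↭⇒↭ₛ p) u , All-resp-↭ p bound , trans (sym (↭-length p)) len

permWords-sound : (n : ℕ) {w : List ℕ} → w ∈ permWords n → IsPermWord n w
permWords-sound zero (here refl) = [] , [] , refl
permWords-sound (suc n) w∈ with find (∈-concatMap⁻ (inserts 0 ∘ map suc) {xs = permWords n} w∈)
... | v , v∈ , w∈inserts =
  IsPermWord-resp-↭ (suc n) (↭-sym (inserts-↭ 0 (map suc v) w∈inserts)) (shifted (permWords-sound n v∈))
  where
  shifted : IsPermWord n v → IsPermWord (suc n) (0 ∷ map suc v)
  shifted (u , bound , len) =
    All.map (λ 0<y 0≡y → <-irrefl 0≡y 0<y) (map-suc-positive v) ∷ Unique.map⁺ suc-injective u ,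
    s≤s z≤n ∷ All.map⁺ (All.map s≤s bound) ,
    cong suc (trans (length-map suc v) len)

IsPermWord⇒∈ : (n : ℕ) {w : List ℕ} {x : ℕ} → IsPermWord n w → x < n → x ∈ w
IsPermWord⇒∈ n {w} (u , bound , len) x<n =
  ⊆-by-length _≟_ u (λ z∈ → ∈-upTo⁺ (All.lookup bound z∈))
    (subst₂ _≤_ (sym (length-upTo n)) (sym len) ≤-refl) (∈-upTo⁺ x<n)

permWords-complete : (n : ℕ) (w : List ℕ) → IsPermWord n w → w ∈ permWords n
permWords-complete zero [] _ = here refl
permWords-complete (suc n) w isPW@(u , bound , len) with ∈-∃++ (IsPermWord⇒∈ (suc n) {x = 0} isPW (s≤s z≤n))
... | pre , suf , refl = ∈-concatMap⁺ (inserts 0 ∘ map suc) (lose v∈ w∈inserts)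
  where
  u′ : Unique (0 ∷ pre ++ suf)
  u′ = Unique-resp-↭ (setoid ℕ) (↭⇒↭ₛ (shift 0 pre suf)) u
  bound′ : All (_< suc n) (pre ++ suf)
  bound′ = All.tail (All-resp-↭ (shift 0 pre suf) bound)
  positive : Positive (pre ++ suf)
  positive = All.tabulate (λ y∈ → n≢0⇒n>0 (λ y≡0 → Unique.Unique[x∷xs]⇒x∉xs u′ (subst (_∈ pre ++ suf) y≡0 y∈)))
  v : List ℕ
  v = map pred (pre ++ suf)
  suc-pred : ∀ {ys} → Positive ys → map suc (map pred ys) ≡ ys
  suc-pred [] = refl
  suc-pred {suc y ∷ ys} (_ ∷ pos) = cong (suc y ∷_) (suc-pred pos)
  isPW-v : IsPermWord n v
  isPW-v =
    Unique.map⁻ (subst Unique (sym (suc-pred positive)) (Unique.drop⁺ 1 u′)) ,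
    All.map⁺ (All.zipWith (λ { {suc _} (s≤s y<n , _) → y<n ; {zero} (_ , ()) }) (bound′ , positive)) ,
    trans (length-map pred (pre ++ suf)) (suc-injective (trans (↭-length (↭-sym (shift 0 pre suf))) len))
  v∈ : v ∈ permWords n
  v∈ = permWords-complete n v isPW-v
  w∈inserts : pre ++ 0 ∷ suf ∈ inserts 0 (map suc v)
  w∈inserts = subst (λ t → pre ++ 0 ∷ suf ∈ inserts 0 t) (sym (suc-pred positive)) (∈-inserts 0 pre suf)

-- Occurrences of 2-1-2′ and left-to-right minima under inserting 0

countGt-map-suc : (y : ℕ) (zs : List ℕ) → countGt (suc y) (map suc zs) ≡ countGt y zs
countGt-map-suc y [] = refl
countGt-map-suc y (z ∷ zs) = cong (indicator (y <ᵇ z) +_) (countGt-map-suc y zs)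

pairs212-map-suc : (x : ℕ) (ys : List ℕ) → pairs212 (suc x) (map suc ys) ≡ pairs212 x ys
pairs212-map-suc x [] = refl
pairs212-map-suc x (y ∷ ys) with y <ᵇ x
... | true = cong₂ _+_ (countGt-map-suc y ys) (pairs212-map-suc x ys)
... | false = pairs212-map-suc x ys

occ212-map-suc : (w : List ℕ) → occ212 (map suc w) ≡ occ212 w
occ212-map-suc [] = refl
occ212-map-suc (x ∷ w) = cong₂ _+_ (pairs212-map-suc x w) (occ212-map-suc w)

pairs212-zero : (ys : List ℕ) → pairs212 0 ys ≡ 0
pairs212-zero [] = refl
pairs212-zero (zero ∷ ys) = pairs212-zero ys
pairs212-zero (suc y ∷ ys) = pairs212-zero ys

occ212-zero-∷ : (w : List ℕ) → occ212 (0 ∷ map suc w) ≡ occ212 w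
occ212-zero-∷ w = cong₂ _+_ (pairs212-zero (map suc w)) (occ212-map-suc w)

countGt-zero : (ys : List ℕ) → Positive ys → countGt 0 ys ≡ length ys
countGt-zero [] _ = refl
countGt-zero (suc y ∷ ys) (_ ∷ pos) = cong suc (countGt-zero ys pos)

countGt-insert-zero : (a : ℕ) (xs ys : List ℕ) → countGt a (xs ++ 0 ∷ ys) ≡ countGt a (xs ++ ys)
countGt-insert-zero zero [] ys = refl
countGt-insert-zero (suc a) [] ys = refl
countGt-insert-zero a (x ∷ xs) ys = cong (indicator (a <ᵇ x) +_) (countGt-insert-zero a xs ys)

pairs212-insert-zero : (x : ℕ) (xs ys : List ℕ) → 0 < x → Positive ys →
  pairs212 x (xs ++ 0 ∷ ys) ≡ pairs212 x (xs ++ ys) + length ys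
pairs212-insert-zero (suc x) [] ys _ pos =
  trans (cong (_+ pairs212 (suc x) ys) (countGt-zero ys pos)) (+-comm (length ys) _)
pairs212-insert-zero x (a ∷ xs) ys 0<x pos with a <ᵇ x
... | true = trans (cong₂ _+_ (countGt-insert-zero a xs ys) (pairs212-insert-zero x xs ys 0<x pos))
                   (sym (+-assoc (countGt a (xs ++ ys)) _ _))
... | false = pairs212-insert-zero x xs ys 0<x pos

occ212-insert-zero : (xs ys : List ℕ) → Positive xs → Positive ys →
  occ212 (xs ++ 0 ∷ ys) ≡ length xs * length ys + occ212 (xs ++ ys)
occ212-insert-zero [] ys _ _ = cong (_+ occ212 ys) (pairs212-zero ys)
occ212-insert-zero (x ∷ xs) ys (0<x ∷ pos-xs) pos-ys =
  trans (cong₂ _+_ (pairs212-insert-zero x xs ys 0<x pos-ys) (occ212-insert-zero xs ys pos-xs pos-ys))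
        (solve 4 (λ p l a o → (p :+ l) :+ (a :* l :+ o) := (l :+ a :* l) :+ (p :+ o)) refl
               (pairs212 x (xs ++ ys)) (length ys) (length xs) (occ212 (xs ++ ys)))
  where open +-*-Solver

occ212-∷ʳ-zero : (w : List ℕ) → occ212 (map suc w ∷ʳ 0) ≡ occ212 w
occ212-∷ʳ-zero w = begin
  occ212 (map suc w ∷ʳ 0)                            ≡⟨ occ212-insert-zero (map suc w) [] (map-suc-positive w) [] ⟩
  length (map suc w) * 0 + occ212 (map suc w ++ [])
    ≡⟨ cong₂ _+_ (*-zeroʳ (length (map suc w))) (cong occ212 (++-identityʳ (map suc w))) ⟩
  occ212 (map suc w)                                 ≡⟨ occ212-map-suc w ⟩
  occ212 w                                           ∎
  where open ≡-Reasoning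

lrMinimaFrom : ℕ → List ℕ → ℕ
lrMinimaFrom c [] = 0
lrMinimaFrom c (x ∷ xs) = if x <ᵇ c then suc (lrMinimaFrom x xs) else lrMinimaFrom c xs

lrMinima : List ℕ → ℕ
lrMinima [] = 0
lrMinima (x ∷ xs) = suc (lrMinimaFrom x xs)

lrMinimaFrom-zero : (ys : List ℕ) → lrMinimaFrom 0 ys ≡ 0
lrMinimaFrom-zero [] = refl
lrMinimaFrom-zero (zero ∷ ys) = lrMinimaFrom-zero ys
lrMinimaFrom-zero (suc y ∷ ys) = lrMinimaFrom-zero ys

lrMinimaFrom-map-suc : (c : ℕ) (ys : List ℕ) → lrMinimaFrom (suc c) (map suc ys) ≡ lrMinimaFrom c ys
lrMinimaFrom-map-suc c [] = refl
lrMinimaFrom-map-suc c (y ∷ ys) with y <ᵇ c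
... | true = cong suc (lrMinimaFrom-map-suc y ys)
... | false = lrMinimaFrom-map-suc c ys

lrMinimaFrom-∷ʳ-zero : (c : ℕ) (ys : List ℕ) → 0 < c → Positive ys → lrMinimaFrom c (ys ∷ʳ 0) ≡ suc (lrMinimaFrom c ys)
lrMinimaFrom-∷ʳ-zero (suc c) [] _ _ = refl
lrMinimaFrom-∷ʳ-zero c (y ∷ ys) 0<c (0<y ∷ pos) with y <ᵇ c
... | true = cong suc (lrMinimaFrom-∷ʳ-zero y ys 0<y pos)
... | false = lrMinimaFrom-∷ʳ-zero c ys 0<c pos

lrMinima-zero-∷ : (w : List ℕ) → lrMinima (0 ∷ map suc w) ≡ 1
lrMinima-zero-∷ w = cong suc (lrMinimaFrom-zero (map suc w))

lrMinima-∷ʳ-zero : (w : List ℕ) → lrMinima (map suc w ∷ʳ 0) ≡ suc (lrMinima w)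
lrMinima-∷ʳ-zero [] = refl
lrMinima-∷ʳ-zero (x ∷ w) = cong suc (trans (lrMinimaFrom-∷ʳ-zero (suc x) (map suc w) (s≤s z≤n) (map-suc-positive w))
                                           (cong suc (lrMinimaFrom-map-suc x w)))

RejectsRepeats : (List ℕ → Bool) → Set
RejectsRepeats P = ∀ z → 2 ≤ occ212 z → P z ≡ false

two≤*suc : (a b : ℕ) → 1 ≤ a → 3 ≤ a + suc b → 2 ≤ a * suc b
two≤*suc (suc zero) zero _ (s≤s (s≤s ()))
two≤*suc (suc (suc a)) zero _ _ = s≤s (s≤s z≤n)
two≤*suc (suc a) (suc b) _ _ = s≤s (s≤s z≤n)

count-inserts-after : (P : List ℕ → Bool) → RejectsRepeats P → (ys pre : List ℕ) →
  1 ≤ length pre → Positive (pre ++ ys) → 3 ≤ length pre + length ys →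
  count P (map (pre ++_) (inserts 0 ys)) ≡ indicator (P (pre ++ ys ∷ʳ 0))
count-inserts-after P rejects [] pre _ _ _ = +-identityʳ _
count-inserts-after P rejects (y ∷ ys) pre 1≤pre pos 3≤len =
  cong₂ _+_ (cong indicator inner-rejected) rest
  where
  inner-rejected : P (pre ++ 0 ∷ y ∷ ys) ≡ false
  inner-rejected = rejects _ (subst (2 ≤_) (sym (occ212-insert-zero pre (y ∷ ys) (All.++⁻ˡ pre pos) (All.++⁻ʳ pre pos)))
    (≤-trans (two≤*suc (length pre) (length ys) 1≤pre 3≤len) (m≤m+n _ _)))
  pre′ : List ℕ
  pre′ = pre ∷ʳ y
  length-pre′ : length pre′ ≡ suc (length pre)
  length-pre′ = trans (length-++ pre) (+-comm (length pre) 1)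
  rest : count P (map (pre ++_) (map (y ∷_) (inserts 0 ys))) ≡ indicator (P (pre ++ (y ∷ ys) ∷ʳ 0))
  rest = begin
    count P (map (pre ++_) (map (y ∷_) (inserts 0 ys)))
      ≡⟨ cong (count P) (trans (sym (map-∘ (inserts 0 ys))) (map-cong (λ z → sym (++-assoc pre (y ∷ []) z)) (inserts 0 ys))) ⟩
    count P (map (pre′ ++_) (inserts 0 ys))
      ≡⟨ count-inserts-after P rejects ys pre′
           (subst (1 ≤_) (sym length-pre′) (s≤s z≤n))
           (subst Positive (sym (++-assoc pre (y ∷ []) ys)) pos)
           (subst (λ l → 3 ≤ l + length ys) (sym length-pre′) (subst (3 ≤_) (+-suc (length pre) (length ys)) 3≤len)) ⟩
    indicator (P (pre′ ++ ys ∷ʳ 0))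
      ≡⟨ cong (indicator ∘ P) (++-assoc pre (y ∷ []) (ys ∷ʳ 0)) ⟩
    indicator (P (pre ++ (y ∷ ys) ∷ʳ 0)) ∎
    where open ≡-Reasoning

count-inserts-zero : (P : List ℕ → Bool) → RejectsRepeats P → (w : List ℕ) → 3 ≤ length w →
  count P (inserts 0 (map suc w)) ≡ indicator (P (0 ∷ map suc w)) + indicator (P (map suc w ∷ʳ 0))
count-inserts-zero P rejects (x ∷ w) 3≤len = cong (indicator (P (0 ∷ map suc (x ∷ w))) +_)
  (count-inserts-after P rejects (map suc w) (suc x ∷ []) (s≤s z≤n) (map-suc-positive (x ∷ w))
    (subst (3 ≤_) (cong suc (sym (length-map suc w))) 3≤len))

single : List ℕ → Bool
single w = occ212 w ≡ᵇ 1

hasType : ℕ → ℕ → List ℕ → Bool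
hasType k m w = (lrMinima w ≡ᵇ m) ∧ (occ212 w ≡ᵇ k)

single-rejectsRepeats : RejectsRepeats single
single-rejectsRepeats z 2≤occ with occ212 z
single-rejectsRepeats z (s≤s (s≤s _)) | suc (suc _) = refl

hasType-1-rejectsRepeats : (m : ℕ) → RejectsRepeats (hasType 1 m)
hasType-1-rejectsRepeats m z 2≤occ with occ212 z
hasType-1-rejectsRepeats m z (s≤s (s≤s _)) | suc (suc _) = ∧-zeroʳ _

length-permWords : (N : ℕ) {w : List ℕ} → w ∈ permWords N → length w ≡ N
length-permWords N w∈ = proj₂ (proj₂ (permWords-sound N w∈))

count-permWords-suc : (P : List ℕ → Bool) → RejectsRepeats P → (N : ℕ) → 3 ≤ N →
  count P (permWords (suc N)) ≡
    count (λ w → P (0 ∷ map suc w)) (permWords N) + count (λ w → P (map suc w ∷ʳ 0)) (permWords N)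
count-permWords-suc P rejects N 3≤N = count-concatMap-split (inserts 0 ∘ map suc) P _ _ (permWords N)
  (λ {w} w∈ → count-inserts-zero P rejects w (subst (3 ≤_) (sym (length-permWords N w∈)) 3≤N))

count-single-suc : (N : ℕ) → 3 ≤ N → count single (permWords (suc N)) ≡ count single (permWords N) + count single (permWords N)
count-single-suc N 3≤N = trans (count-permWords-suc single single-rejectsRepeats N 3≤N)
  (cong₂ _+_ (count-cong (permWords N) (λ {w} _ → cong (_≡ᵇ 1) (occ212-zero-∷ w)))
             (count-cong (permWords N) (λ {w} _ → cong (_≡ᵇ 1) (occ212-∷ʳ-zero w))))

lrMinima-nonempty : (w : List ℕ) → 1 ≤ length w → (lrMinima w ≡ᵇ 0) ≡ false
lrMinima-nonempty (_ ∷ _) _ = refl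

count-hasType-1-1-suc : (N : ℕ) → 3 ≤ N → count (hasType 1 1) (permWords (suc N)) ≡ count single (permWords N)
count-hasType-1-1-suc N 3≤N = trans (count-permWords-suc (hasType 1 1) (hasType-1-rejectsRepeats 1) N 3≤N)
  (trans (cong₂ _+_ (count-cong (permWords N) front) (trans (count-cong (permWords N) back) (count-false (permWords N))))
         (+-identityʳ _))
  where
  front : ∀ {w} → w ∈ permWords N → hasType 1 1 (0 ∷ map suc w) ≡ single w
  front {w} _ = cong₂ (λ l o → (l ≡ᵇ 1) ∧ (o ≡ᵇ 1)) (lrMinima-zero-∷ w) (occ212-zero-∷ w)
  back : ∀ {w} → w ∈ permWords N → hasType 1 1 (map suc w ∷ʳ 0) ≡ false
  back {w} w∈ rewrite lrMinima-∷ʳ-zero w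
    | lrMinima-nonempty w (≤-trans (s≤s z≤n) (subst (3 ≤_) (sym (length-permWords N w∈)) 3≤N)) = refl

count-hasType-1-suc-suc : (N m : ℕ) → 3 ≤ N →
  count (hasType 1 (suc (suc m))) (permWords (suc N)) ≡ count (hasType 1 (suc m)) (permWords N)
count-hasType-1-suc-suc N m 3≤N = trans (count-permWords-suc (hasType 1 (suc (suc m))) (hasType-1-rejectsRepeats _) N 3≤N)
  (cong₂ _+_ (trans (count-cong (permWords N) front) (count-false (permWords N)))
             (count-cong (permWords N) back))
  where
  front : ∀ {w} → w ∈ permWords N → hasType 1 (suc (suc m)) (0 ∷ map suc w) ≡ false
  front {w} _ rewrite lrMinimaFrom-zero (map suc w) = refl
  back : ∀ {w} → w ∈ permWords N → hasType 1 (suc (suc m)) (map suc w ∷ʳ 0) ≡ hasType 1 (suc m) w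
  back {w} _ = cong₂ (λ l o → (l ≡ᵇ suc (suc m)) ∧ (o ≡ᵇ 1)) (lrMinima-∷ʳ-zero w) (occ212-∷ʳ-zero w)

3≤3+ : (k : ℕ) → 3 ≤ 3 + k
3≤3+ k = s≤s (s≤s (s≤s z≤n))

count-single : (k : ℕ) → count single (permWords (3 + k)) ≡ 2 ^ suc k
count-single zero = refl
count-single (suc k) = begin
  count single (permWords (4 + k))                                   ≡⟨ count-single-suc (3 + k) (3≤3+ k) ⟩
  count single (permWords (3 + k)) + count single (permWords (3 + k)) ≡⟨ cong (λ c → c + c) (count-single k) ⟩
  2 ^ suc k + 2 ^ suc k                                              ≡⟨ cong (2 ^ suc k +_) (sym (+-identityʳ (2 ^ suc k))) ⟩
  2 ^ suc (suc k)                                                    ∎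
  where open ≡-Reasoning

count-hasType-1-below : (k m : ℕ) → 1 ≤ m → m ≤ k → count (hasType 1 m) (permWords (3 + k)) ≡ 2 ^ (3 + k ∸ m ∸ 2)
count-hasType-1-below (suc k) (suc zero) _ _ = trans (count-hasType-1-1-suc (3 + k) (3≤3+ k)) (count-single k)
count-hasType-1-below (suc k) (suc (suc m)) _ (s≤s m<k) =
  trans (count-hasType-1-suc-suc (3 + k) m (3≤3+ k)) (count-hasType-1-below k (suc m) (s≤s z≤n) m<k)

count-hasType-1-diagonal : (c k : ℕ) → count (hasType 1 (suc c + k)) (permWords (3 + k)) ≡ count (hasType 1 (suc c)) (permWords 3)
count-hasType-1-diagonal c zero rewrite +-identityʳ c = refl
count-hasType-1-diagonal c (suc k) rewrite +-suc c k =
  trans (count-hasType-1-suc-suc (3 + k) (c + k) (3≤3+ k)) (count-hasType-1-diagonal c k)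

-- Blocks of a word and their cycles

<ᵇ-true⇒< : (x c : ℕ) → (x <ᵇ c) ≡ true → x < c
<ᵇ-true⇒< x c eq = <ᵇ⇒< x c (subst T (sym eq) tt)

<ᵇ-false⇒≥ : (x c : ℕ) → (x <ᵇ c) ≡ false → c ≤ x
<ᵇ-false⇒≥ x c eq = ≮⇒≥ (λ x<c → subst T eq (<⇒<ᵇ x<c))

<⇒<ᵇ≡true : {x c : ℕ} → x < c → (x <ᵇ c) ≡ true
<⇒<ᵇ≡true {x} {c} x<c with x <ᵇ c | <⇒<ᵇ x<c
... | true | _ = refl

≥⇒<ᵇ≡false : {x c : ℕ} → c ≤ x → (x <ᵇ c) ≡ false
≥⇒<ᵇ≡false {x} {c} c≤x with x <ᵇ c in eq
... | false = refl
... | true = ⊥-elim (<-irrefl refl (<-≤-trans (<ᵇ-true⇒< x c eq) c≤x))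

≡ᵇ-refl : (a : ℕ) → (a ≡ᵇ a) ≡ true
≡ᵇ-refl zero = refl
≡ᵇ-refl (suc a) = ≡ᵇ-refl a

≢⇒≡ᵇ≡false : {a b : ℕ} → a ≢ b → (a ≡ᵇ b) ≡ false
≢⇒≡ᵇ≡false {a} {b} a≢b with a ≡ᵇ b in eq
... | false = refl
... | true = ⊥-elim (a≢b (≡ᵇ⇒≡ a b (subst T (sym eq) tt)))

Block : Set
Block = ℕ × List ℕ

blockWord : Block → List ℕ
blockWord (b , bs) = b ∷ bs

blocksFrom : ℕ → List ℕ → List ℕ → List Block
blocksFrom c cs [] = (c , cs) ∷ []
blocksFrom c cs (x ∷ xs) = if x <ᵇ c then (c , cs) ∷ blocksFrom x [] xs else blocksFrom c (cs ∷ʳ x) xs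

blocks : List ℕ → List Block
blocks [] = []
blocks (x ∷ xs) = blocksFrom x [] xs

concat-blocksFrom : (c : ℕ) (cs xs : List ℕ) → concat (map blockWord (blocksFrom c cs xs)) ≡ c ∷ cs ++ xs
concat-blocksFrom c cs [] = refl
concat-blocksFrom c cs (x ∷ xs) with x <ᵇ c
... | true = cong ((c ∷ cs) ++_) (concat-blocksFrom x [] xs)
... | false = trans (concat-blocksFrom c (cs ∷ʳ x) xs) (cong (c ∷_) (++-assoc cs (x ∷ []) xs))

concat-blocks : (w : List ℕ) → concat (map blockWord (blocks w)) ≡ w
concat-blocks [] = refl
concat-blocks (x ∷ xs) = concat-blocksFrom x [] xs

length-blocksFrom : (c : ℕ) (cs xs : List ℕ) → length (blocksFrom c cs xs) ≡ suc (lrMinimaFrom c xs)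
length-blocksFrom c cs [] = refl
length-blocksFrom c cs (x ∷ xs) with x <ᵇ c
... | true = cong suc (length-blocksFrom x [] xs)
... | false = length-blocksFrom c (cs ∷ʳ x) xs

length-blocks : (w : List ℕ) → length (blocks w) ≡ lrMinima w
length-blocks [] = refl
length-blocks (x ∷ xs) = length-blocksFrom x [] xs

blocksFrom-head-min : (c : ℕ) (cs xs : List ℕ) → All (c ≤_) cs →
  ∀ {b bs} → (b , bs) ∈ blocksFrom c cs xs → All (b ≤_) bs
blocksFrom-head-min c cs [] c≤cs (here refl) = c≤cs
blocksFrom-head-min c cs (x ∷ xs) c≤cs b∈ with x <ᵇ c in eq
blocksFrom-head-min c cs (x ∷ xs) c≤cs (here refl) | true = c≤cs
blocksFrom-head-min c cs (x ∷ xs) c≤cs (there b∈) | true = blocksFrom-head-min x [] xs [] b∈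
... | false = blocksFrom-head-min c (cs ∷ʳ x) xs (All.++⁺ c≤cs (<ᵇ-false⇒≥ x c eq ∷ [])) b∈

blocks-head-min : (w : List ℕ) {b : ℕ} {bs : List ℕ} → (b , bs) ∈ blocks w → All (b ≤_) bs
blocks-head-min (x ∷ xs) = blocksFrom-head-min x [] xs []

Decreasing : List ℕ → Set
Decreasing = AllPairs (λ a b → b < a)

blocksFrom-heads : (c : ℕ) (cs xs : List ℕ) →
  ∃ λ rest → map proj₁ (blocksFrom c cs xs) ≡ c ∷ rest × All (_< c) rest × Decreasing (c ∷ rest)
blocksFrom-heads c cs [] = [] , refl , [] , ([] ∷ [])
blocksFrom-heads c cs (x ∷ xs) with x <ᵇ c in eq
... | false = blocksFrom-heads c (cs ∷ʳ x) xs
... | true with blocksFrom-heads x [] xs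
...   | rest , heads≡ , rest<x , decreasing = x ∷ rest , cong (c ∷_) heads≡ , below , (below ∷ decreasing)
  where
  x<c : x < c
  x<c = <ᵇ-true⇒< x c eq
  below : All (_< c) (x ∷ rest)
  below = x<c ∷ All.map (λ y<x → <-trans y<x x<c) rest<x

blocks-heads-decreasing : (w : List ℕ) → Decreasing (map proj₁ (blocks w))
blocks-heads-decreasing [] = []
blocks-heads-decreasing (x ∷ xs) with blocksFrom-heads x [] xs
... | _ , heads≡ , _ , decreasing = subst Decreasing (sym heads≡) decreasing

blocks-heads-tails : (bss : List Block) → concat (map blockWord bss) ↭ map proj₁ bss ++ concat (map proj₂ bss)
blocks-heads-tails [] = ↭.refl
blocks-heads-tails ((b , bs) ∷ bss) = ↭.prep b (↭.trans (↭.++⁺ˡ bs (blocks-heads-tails bss)) (shifts bs (map proj₁ bss)))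

cycleEdges : ℕ → ℕ → List ℕ → List (ℕ × ℕ)
cycleEdges first x [] = (x , first) ∷ []
cycleEdges first x (y ∷ ys) = (x , y) ∷ cycleEdges first y ys

blockEdges : Block → List (ℕ × ℕ)
blockEdges (b , bs) = cycleEdges b b bs

edgeTable : List ℕ → List (ℕ × ℕ)
edgeTable w = concatMap blockEdges (blocks w)

sources-cycleEdges : (first x : ℕ) (ys : List ℕ) → map proj₁ (cycleEdges first x ys) ≡ x ∷ ys
sources-cycleEdges first x [] = refl
sources-cycleEdges first x (y ∷ ys) = cong (x ∷_) (sources-cycleEdges first y ys)

targets-cycleEdges : (first x : ℕ) (ys : List ℕ) → map proj₂ (cycleEdges first x ys) ≡ ys ∷ʳ first
targets-cycleEdges first x [] = refl
targets-cycleEdges first x (y ∷ ys) = cong (y ∷_) (targets-cycleEdges first y ys)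

sources-edgeTable : (w : List ℕ) → map proj₁ (edgeTable w) ≡ w
sources-edgeTable w = begin
  map proj₁ (edgeTable w)                                     ≡⟨ map-concatMap proj₁ blockEdges (blocks w) ⟩
  concat (map (map proj₁ ∘ blockEdges) (blocks w))
    ≡⟨ cong concat (map-cong (λ { (b , bs) → sources-cycleEdges b b bs }) (blocks w)) ⟩
  concat (map blockWord (blocks w))                           ≡⟨ concat-blocks w ⟩
  w                                                           ∎
  where open ≡-Reasoning

targets-edgeTable : (w : List ℕ) → map proj₂ (edgeTable w) ↭ w
targets-edgeTable w = subst (_↭ w) (sym (map-concatMap proj₂ blockEdges (blocks w)))
  (subst (concat (map (map proj₂ ∘ blockEdges) (blocks w)) ↭_) (concat-blocks w) (go (blocks w)))
  where
  go : (bss : List Block) → concat (map (map proj₂ ∘ blockEdges) bss) ↭ concat (map blockWord bss)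
  go [] = ↭.refl
  go ((b , bs) ∷ bss) = ↭.++⁺ (subst (_↭ b ∷ bs) (sym (targets-cycleEdges b b bs)) (++-comm bs (b ∷ []))) (go bss)

-- junk value 0 for an absent key
lookupEdge : List (ℕ × ℕ) → ℕ → ℕ
lookupEdge [] x = 0
lookupEdge ((a , c) ∷ es) x = if a ≡ᵇ x then c else lookupEdge es x

successor : List ℕ → ℕ → ℕ
successor w = lookupEdge (edgeTable w)

lookupEdge-∈ : (es : List (ℕ × ℕ)) {a c : ℕ} → Unique (map proj₁ es) → (a , c) ∈ es → lookupEdge es a ≡ c
lookupEdge-∈ ((a , c) ∷ es) u (here refl) rewrite ≡ᵇ-refl a = refl
lookupEdge-∈ ((a′ , c′) ∷ es) {a} (a′∉ ∷ u) (there e∈)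
  rewrite ≢⇒≡ᵇ≡false (All.lookup a′∉ (∈-map⁺ proj₁ e∈)) = lookupEdge-∈ es u e∈

targets-injective : (es : List (ℕ × ℕ)) {a a′ c : ℕ} → Unique (map proj₂ es) →
  (a , c) ∈ es → (a′ , c) ∈ es → a ≡ a′
targets-injective (_ ∷ es) u (here refl) (here refl) = refl
targets-injective (_ ∷ es) (c∉ ∷ u) (here refl) (there e∈) = ⊥-elim (All.lookup c∉ (∈-map⁺ proj₂ e∈) refl)
targets-injective (_ ∷ es) (c∉ ∷ u) (there e∈) (here refl) = ⊥-elim (All.lookup c∉ (∈-map⁺ proj₂ e∈) refl)
targets-injective (_ ∷ es) (_ ∷ u) (there e∈) (there e′∈) = targets-injective es u e∈ e′∈

module Successor (w : List ℕ) (u : Unique w) where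

  unique-sources : Unique (map proj₁ (edgeTable w))
  unique-sources = subst Unique (sym (sources-edgeTable w)) u

  unique-targets : Unique (map proj₂ (edgeTable w))
  unique-targets = Unique-resp-↭ (setoid ℕ) (↭⇒↭ₛ (↭-sym (targets-edgeTable w))) u

  successor-edge : {a c : ℕ} → (a , c) ∈ edgeTable w → successor w a ≡ c
  successor-edge = lookupEdge-∈ (edgeTable w) unique-sources

  edge-successor : {a : ℕ} → a ∈ w → (a , successor w a) ∈ edgeTable w
  edge-successor a∈ with ∈-map⁻ proj₁ (subst (_ ∈_) (sym (sources-edgeTable w)) a∈)
  ... | (a , c) , e∈ , refl = subst (λ t → (a , t) ∈ edgeTable w) (sym (successor-edge e∈)) e∈

  successor-∈ : {a : ℕ} → a ∈ w → successor w a ∈ w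
  successor-∈ a∈ = ∈-resp-↭ (targets-edgeTable w) (∈-map⁺ proj₂ (edge-successor a∈))

  successor-injective : {a a′ : ℕ} → a ∈ w → a′ ∈ w → successor w a ≡ successor w a′ → a ≡ a′
  successor-injective a∈ a′∈ eq = targets-injective (edgeTable w) unique-targets (edge-successor a∈)
    (subst (λ t → (_ , t) ∈ edgeTable w) (sym eq) (edge-successor a′∈))

-- The permutation of a word

fromℕ<-or : {n : ℕ} → Fin n → ℕ → Fin n
fromℕ<-or {n} d x with x <? n
... | yes x<n = fromℕ< x<n
... | no _ = d

toℕ-fromℕ<-or : {n : ℕ} (d : Fin n) {x : ℕ} → x < n → toℕ (fromℕ<-or d x) ≡ x
toℕ-fromℕ<-or {n} d {x} x<n with x <? n
... | yes x<n′ = Fin.toℕ-fromℕ< x<n′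
... | no x≮n = ⊥-elim (x≮n x<n)

-- The fallback i of fromℕ<-or is junk: it is never reached when w is a permutation word.
wordPerm : (n : ℕ) → List ℕ → Vec (Fin n) n
wordPerm n w = tabulate (λ i → fromℕ<-or i (successor w (toℕ i)))

toℕ-lookup-wordPerm : (n : ℕ) {w : List ℕ} → IsPermWord n w → (j : Fin n) →
  toℕ (lookup (wordPerm n w) j) ≡ successor w (toℕ j)
toℕ-lookup-wordPerm n {w} isPW@(u , bound , _) j =
  trans (cong toℕ (Vec.lookup∘tabulate _ j))
    (toℕ-fromℕ<-or j (All.lookup bound (Successor.successor-∈ w u (IsPermWord⇒∈ n isPW (Fin.toℕ<n j)))))

orbitℕ : (ℕ → ℕ) → ℕ → ℕ → ℕ → List ℕ
orbitℕ σ zero s x = []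
orbitℕ σ (suc fuel) s x = x ∷ (if σ x ≡ᵇ s then [] else orbitℕ σ fuel s (σ x))

orbitGo≡orbitℕ : {n : ℕ} (π : Vec (Fin n) n) (σ : ℕ → ℕ) → (∀ j → toℕ (lookup π j) ≡ σ (toℕ j)) →
  (fuel s : ℕ) (j : Fin n) → orbitGo π fuel s j ≡ orbitℕ σ fuel s (toℕ j)
orbitGo≡orbitℕ π σ π≗σ zero s j = refl
orbitGo≡orbitℕ π σ π≗σ (suc fuel) s j
  rewrite π≗σ j | orbitGo≡orbitℕ π σ π≗σ fuel s (lookup π j) | π≗σ j = refl

Follows : (ℕ → ℕ) → List (ℕ × ℕ) → Set
Follows σ es = ∀ {e} → e ∈ es → σ (proj₁ e) ≡ proj₂ e

orbitℕ-cycle : (σ : ℕ → ℕ) (b : ℕ) (ys : List ℕ) (x fuel : ℕ) → Follows σ (cycleEdges b x ys) →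
  All (b ≢_) ys → suc (length ys) ≤ fuel → orbitℕ σ fuel b x ≡ x ∷ ys
orbitℕ-cycle σ b [] x (suc fuel) follows _ _ rewrite follows (here refl) | ≡ᵇ-refl b = refl
orbitℕ-cycle σ b (y ∷ ys) x (suc fuel) follows (b≢y ∷ b∉ys) (s≤s len≤)
  rewrite follows (here refl) | ≢⇒≡ᵇ≡false (b≢y ∘ sym) =
  cong (x ∷_) (orbitℕ-cycle σ b ys y fuel (follows ∘ there) b∉ys len≤)

∈-orbitℕ-cycle : (σ : ℕ → ℕ) (b : ℕ) (ys : List ℕ) (x fuel s : ℕ) → Follows σ (cycleEdges b x ys) →
  All (s ≢_) ys → s ≢ b → suc (suc (length ys)) ≤ fuel → b ∈ orbitℕ σ fuel s x
∈-orbitℕ-cycle σ b [] x (suc zero) s _ _ _ (s≤s ())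
∈-orbitℕ-cycle σ b [] x (suc (suc fuel)) s follows _ s≢b _ rewrite follows (here refl) | ≢⇒≡ᵇ≡false (s≢b ∘ sym) =
  there (here refl)
∈-orbitℕ-cycle σ b (y ∷ ys) x (suc fuel) s follows (s≢y ∷ s∉ys) s≢b (s≤s len≤)
  rewrite follows (here refl) | ≢⇒≡ᵇ≡false (s≢y ∘ sym) =
  there (∈-orbitℕ-cycle σ b ys y fuel s (follows ∘ there) s∉ys s≢b len≤)

cycleEdges-suffix : (first x : ℕ) (pre : List ℕ) (y : ℕ) (post : List ℕ) →
  cycleEdges first y post ⊆ cycleEdges first x (pre ++ y ∷ post)
cycleEdges-suffix first x [] y post e∈ = there e∈
cycleEdges-suffix first x (p ∷ pre) y post e∈ = there (cycleEdges-suffix first p pre y post e∈)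

allGeᵇ-true : (x : ℕ) (ys : List ℕ) → All (x ≤_) ys → allGeᵇ x ys ≡ true
allGeᵇ-true x [] _ = refl
allGeᵇ-true x (y ∷ ys) (x≤y ∷ x≤ys) rewrite ≥⇒<ᵇ≡false x≤y = allGeᵇ-true x ys x≤ys

allGeᵇ-false : (x : ℕ) (ys : List ℕ) {y : ℕ} → y ∈ ys → y < x → allGeᵇ x ys ≡ false
allGeᵇ-false x (y ∷ ys) (here refl) y<x rewrite <⇒<ᵇ≡true y<x = refl
allGeᵇ-false x (z ∷ ys) (there y∈) y<x with not (z <ᵇ x)
... | true = allGeᵇ-false x ys y∈ y<x
... | false = refl

elemᵇ-true : (x : ℕ) (ys : List ℕ) → x ∈ ys → elemᵇ x ys ≡ true
elemᵇ-true x (y ∷ ys) (here refl) rewrite ≡ᵇ-refl x = refl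
elemᵇ-true x (y ∷ ys) (there x∈) with x ≡ᵇ y
... | true = refl
... | false = elemᵇ-true x ys x∈

elemᵇ-false : (x : ℕ) (ys : List ℕ) → x ∉ ys → elemᵇ x ys ≡ false
elemᵇ-false x [] _ = refl
elemᵇ-false x (y ∷ ys) x∉ rewrite ≢⇒≡ᵇ≡false (x∉ ∘ here) = elemᵇ-false x ys (x∉ ∘ there)

elemᵇ⇒∈ : (x : ℕ) (ys : List ℕ) → elemᵇ x ys ≡ true → x ∈ ys
elemᵇ⇒∈ x (y ∷ ys) eq with x ≡ᵇ y in x≡ᵇy
... | true = here (≡ᵇ⇒≡ x y (subst T (sym x≡ᵇy) tt))
... | false = there (elemᵇ⇒∈ x ys eq)

reverse-filterᵇ-upTo : (n : ℕ) (p : ℕ → Bool) (S : List ℕ) → Decreasing S → All (_< n) S →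
  (∀ {x} → x < n → p x ≡ true → x ∈ S) → (∀ {x} → x ∈ S → p x ≡ true) → reverse (filterᵇ p (upTo n)) ≡ S
reverse-filterᵇ-upTo zero p [] _ _ _ _ = refl
reverse-filterᵇ-upTo zero p (_ ∷ _) _ (() ∷ _) _ _
reverse-filterᵇ-upTo (suc n) p S decreasing bound complete sound = begin
  reverse (filterᵇ p (upTo (suc n)))                 ≡⟨ cong (reverse ∘ filterᵇ p) (sym (upTo-∷ʳ n)) ⟩
  reverse (filterᵇ p (upTo n ∷ʳ n))                  ≡⟨ cong reverse (filter-++ (T? ∘ p) (upTo n) (n ∷ [])) ⟩
  reverse (filterᵇ p (upTo n) ++ filterᵇ p (n ∷ [])) ≡⟨ last-step ⟩
  S                                                  ∎
  where
  open ≡-Reasoning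
  n-first : (S : List ℕ) → Decreasing S → All (_< suc n) S → (∀ {x} → x < suc n → p x ≡ true → x ∈ S) →
    (∀ {x} → x ∈ S → p x ≡ true) → n ∈ S → n ∷ reverse (filterᵇ p (upTo n)) ≡ S
  n-first (s ∷ S′) (s>S′ ∷ _) (s<1+n ∷ _) _ _ (there n∈S′) =
    ⊥-elim (<-irrefl refl (<-≤-trans (All.lookup s>S′ n∈S′) (≤-pred s<1+n)))
  n-first (.n ∷ S′) (n>S′ ∷ decreasing′) _ complete sound (here refl) =
    cong (n ∷_) (reverse-filterᵇ-upTo n p S′ decreasing′ n>S′ complete′ (sound ∘ there))
    where
    complete′ : ∀ {x} → x < n → p x ≡ true → x ∈ S′
    complete′ x<n px with complete (m≤n⇒m≤1+n x<n) px
    ... | here refl = ⊥-elim (<-irrefl refl x<n)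
    ... | there x∈ = x∈
  last-step : reverse (filterᵇ p (upTo n) ++ filterᵇ p (n ∷ [])) ≡ S
  last-step with p n in pn
  ... | true = trans (reverse-++ (filterᵇ p (upTo n)) (n ∷ [])) (n-first S decreasing bound complete sound (complete ≤-refl pn))
  ... | false = trans (cong reverse (++-identityʳ (filterᵇ p (upTo n))))
    (reverse-filterᵇ-upTo n p S decreasing
      (All.tabulate (λ {x} x∈ → ≤∧≢⇒< (≤-pred (All.lookup bound x∈)) (λ x≡n → n∉S (subst (_∈ S) x≡n x∈))))
      (λ x<n → complete (m≤n⇒m≤1+n x<n)) sound)
    where
    n∉S : n ∉ S
    n∉S n∈ with trans (sym (sound n∈)) pn
    ... | ()

map-toℕ-filterᵇ : {n : ℕ} (p : Fin n → Bool) (q : ℕ → Bool) → (∀ i → p i ≡ q (toℕ i)) →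
  (is : List (Fin n)) → map toℕ (filterᵇ p is) ≡ filterᵇ q (map toℕ is)
map-toℕ-filterᵇ p q p≗q [] = refl
map-toℕ-filterᵇ p q p≗q (i ∷ is) rewrite p≗q i with q (toℕ i)
... | true = cong (toℕ i ∷_) (map-toℕ-filterᵇ p q p≗q is)
... | false = map-toℕ-filterᵇ p q p≗q is

map-toℕ-allFin : (n : ℕ) → map toℕ (allFin n) ≡ upTo n
map-toℕ-allFin n = go id id (λ _ → refl)
  where
  go : {m k : ℕ} (g : Fin m → Fin k) (h : ℕ → ℕ) → (∀ i → toℕ (g i) ≡ h (toℕ i)) →
    map toℕ (Data.List.tabulate g) ≡ applyUpTo h m
  go {zero} g h g≗h = refl
  go {suc m} g h g≗h = cong₂ _∷_ (g≗h fzero) (go (g ∘ fsuc) (h ∘ suc) (g≗h ∘ fsuc))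

module WordPerm (n : ℕ) (w : List ℕ) (isPW : IsPermWord n w) where

  open Successor w (proj₁ isPW)

  π : Vec (Fin n) n
  π = wordPerm n w

  heads : List ℕ
  heads = map proj₁ (blocks w)

  blocks-unique : Unique (concat (map blockWord (blocks w)))
  blocks-unique = subst Unique (sym (concat-blocks w)) (proj₁ isPW)

  heads∉tails : ∀ {x} → x ∈ heads → x ∉ concat (map proj₂ (blocks w))
  heads∉tails = proj₂ (proj₂ (Unique-++⁻ heads
    (Unique-resp-↭ (setoid ℕ) (↭⇒↭ₛ (blocks-heads-tails (blocks w))) blocks-unique)))

  module _ {b : ℕ} {bs : List ℕ} (b∈ : (b , bs) ∈ blocks w) where

    block-unique : Unique (b ∷ bs)
    block-unique = Unique-concat⁻ blocks-unique (∈-map⁺ blockWord b∈)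

    block-⊆ : b ∷ bs ⊆ w
    block-⊆ x∈ = subst (_ ∈_) (concat-blocks w) (∈-concat⁺′ x∈ (∈-map⁺ blockWord b∈))

    block-length : length (b ∷ bs) ≤ n
    block-length = subst (length (b ∷ bs) ≤_) (length-upTo n)
      (length-⊆ block-unique (λ x∈ → ∈-upTo⁺ (All.lookup (proj₁ (proj₂ isPW)) (block-⊆ x∈))))

    block-follows : Follows (successor w) (cycleEdges b b bs)
    block-follows e∈ = successor-edge (∈-concatMap⁺ blockEdges (lose b∈ e∈))

    orbit-head : orbitℕ (successor w) n b b ≡ b ∷ bs
    orbit-head with block-unique
    ... | b∉bs ∷ _ = orbitℕ-cycle (successor w) b bs b n block-follows b∉bs block-length

    -- From a non-minimal letter x the orbit runs through the block minimum b < x.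
    head-∈-orbit : ∀ {x} → x ∈ bs → b ∈ orbitℕ (successor w) n x x
    head-∈-orbit {x} x∈ with ∈-∃++ x∈ | block-unique
    ... | pre , post , refl | b∉bs ∷ ubs =
      ∈-orbitℕ-cycle (successor w) b post x n x
        (block-follows ∘ cycleEdges-suffix b b pre x post)
        (AllPairs.head (proj₁ (proj₂ (Unique-++⁻ pre ubs))))
        (λ x≡b → All.lookup b∉bs x∈ (sym x≡b))
        (≤-trans (s≤s (subst (suc (length post) ≤_) (sym (length-++ pre)) (m≤n+m _ _))) block-length)

  orbit≡orbitℕ : (i : Fin n) → orbit π i ≡ orbitℕ (successor w) n (toℕ i) (toℕ i)
  orbit≡orbitℕ i = orbitGo≡orbitℕ π (successor w) (toℕ-lookup-wordPerm n isPW) n (toℕ i) i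

  isCycleMin-wordPerm : (i : Fin n) → isCycleMin π i ≡ elemᵇ (toℕ i) heads
  isCycleMin-wordPerm i with ∈-concat⁻′ (map blockWord (blocks w))
                               (subst (toℕ i ∈_) (sym (concat-blocks w)) (IsPermWord⇒∈ n isPW (Fin.toℕ<n i)))
  ... | _ , i∈block , block∈ with ∈-map⁻ blockWord block∈
  ... | (b , bs) , b∈ , refl with i∈block
  ... | here refl = begin
    allGeᵇ b (orbit π i)                ≡⟨ cong (allGeᵇ b) (trans (orbit≡orbitℕ i) (orbit-head b∈)) ⟩
    allGeᵇ b (b ∷ bs)                   ≡⟨ allGeᵇ-true b (b ∷ bs) (≤-refl ∷ blocks-head-min w b∈) ⟩
    true                                ≡⟨ sym (elemᵇ-true b heads (∈-map⁺ proj₁ b∈)) ⟩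
    elemᵇ b heads                       ∎
    where open ≡-Reasoning
  ... | there i∈bs = begin
    allGeᵇ (toℕ i) (orbit π i)          ≡⟨ cong (allGeᵇ (toℕ i)) (orbit≡orbitℕ i) ⟩
    allGeᵇ (toℕ i) (orbitℕ (successor w) n (toℕ i) (toℕ i))
      ≡⟨ allGeᵇ-false (toℕ i) _ (head-∈-orbit b∈ i∈bs) b<i ⟩
    false
      ≡⟨ sym (elemᵇ-false (toℕ i) heads (λ i∈ → heads∉tails i∈ (∈-concat⁺′ i∈bs (∈-map⁺ proj₂ b∈)))) ⟩
    elemᵇ (toℕ i) heads                 ∎
    where
    open ≡-Reasoning
    b<i : b < toℕ i
    b<i with block-unique b∈
    ... | b∉bs ∷ _ = ≤∧≢⇒< (All.lookup (blocks-head-min w b∈) i∈bs) (All.lookup b∉bs i∈bs)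

  cycleMins-wordPerm : map toℕ (cycleMins π) ≡ heads
  cycleMins-wordPerm = begin
    map toℕ (reverse (filterᵇ (isCycleMin π) (allFin n)))   ≡⟨ reverse-map toℕ (filterᵇ (isCycleMin π) (allFin n)) ⟩
    reverse (map toℕ (filterᵇ (isCycleMin π) (allFin n)))
      ≡⟨ cong reverse (map-toℕ-filterᵇ _ _ isCycleMin-wordPerm (allFin n)) ⟩
    reverse (filterᵇ (λ x → elemᵇ x heads) (map toℕ (allFin n)))
      ≡⟨ cong (reverse ∘ filterᵇ (λ x → elemᵇ x heads)) (map-toℕ-allFin n) ⟩
    reverse (filterᵇ (λ x → elemᵇ x heads) (upTo n))
      ≡⟨ reverse-filterᵇ-upTo n (λ x → elemᵇ x heads) heads (blocks-heads-decreasing w) heads-bound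
           (λ {x} _ → elemᵇ⇒∈ x heads) (λ {x} → elemᵇ-true x heads) ⟩
    heads                                                   ∎
    where
    open ≡-Reasoning
    heads-bound : All (_< n) heads
    heads-bound = All.tabulate (λ h∈ → let _ , b∈ , h≡b = ∈-map⁻ proj₁ h∈ in
      subst (_< n) (sym h≡b) (All.lookup (proj₁ (proj₂ isPW)) (block-⊆ b∈ (here refl))))

  standardCycleForm-wordPerm : standardCycleForm π ≡ map blockWord (blocks w)
  standardCycleForm-wordPerm = go (cycleMins π) (blocks w) cycleMins-wordPerm id
    where
    go : (is : List (Fin n)) (bss : List Block) → map toℕ is ≡ map proj₁ bss → bss ⊆ blocks w →
      map (orbit π) is ≡ map blockWord bss
    go [] [] _ _ = refl
    go (i ∷ is) ((b , bs) ∷ bss) eq bss⊆ = cong₂ _∷_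
      (trans (orbit≡orbitℕ i)
        (trans (cong (λ t → orbitℕ (successor w) n t t) (∷-injectiveˡ eq)) (orbit-head (bss⊆ (here refl)))))
      (go is bss (∷-injectiveʳ eq) (bss⊆ ∘ there))

  Ψ-wordPerm : Ψ π ≡ w
  Ψ-wordPerm = trans (cong concat standardCycleForm-wordPerm) (concat-blocks w)

  numCycles-wordPerm : numCycles π ≡ lrMinima w
  numCycles-wordPerm = trans (cong length standardCycleForm-wordPerm)
    (trans (length-map blockWord (blocks w)) (length-blocks w))

noDupᵇ-true : (xs : List ℕ) → Unique xs → noDupᵇ xs ≡ true
noDupᵇ-true [] _ = refl
noDupᵇ-true (x ∷ xs) (x∉ ∷ u) rewrite elemᵇ-false x xs (λ x∈ → All.lookup x∉ x∈ refl) = noDupᵇ-true xs u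

noDupᵇ⇒Unique : (xs : List ℕ) → noDupᵇ xs ≡ true → Unique xs
noDupᵇ⇒Unique [] _ = []
noDupᵇ⇒Unique (x ∷ xs) nodup with elemᵇ x xs in x∈ᵇ
... | false = All.tabulate (λ y∈ x≡y → x∉ (subst (_∈ xs) (sym x≡y) y∈)) ∷ noDupᵇ⇒Unique xs nodup
  where
  x∉ : x ∉ xs
  x∉ x∈ with trans (sym (elemᵇ-true x xs x∈)) x∈ᵇ
  ... | ()

∈-allVecs : (n k : ℕ) (v : Vec (Fin n) k) → v ∈ allVecs n k
∈-allVecs n zero []ᵥ = here refl
∈-allVecs n (suc k) (x ∷ᵥ v) =
  ∈-concatMap⁺ (λ y → map (y ∷ᵥ_) (allVecs n k)) (lose (∈-allFin x) (∈-map⁺ (x ∷ᵥ_) (∈-allVecs n k v)))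

allVecs-unique : (n k : ℕ) → Unique (allVecs n k)
allVecs-unique n zero = [] ∷ []
allVecs-unique n (suc k) = concatMap-unique (λ y → map (y ∷ᵥ_) (allVecs n k)) Data.Vec.head
  head-left (λ _ → Unique.map⁺ Vec.∷-injectiveʳ (allVecs-unique n k)) (Unique.allFin⁺ n)
  where
  head-left : ∀ {y v} → v ∈ map (y ∷ᵥ_) (allVecs n k) → Data.Vec.head v ≡ y
  head-left v∈ with ∈-map⁻ _ v∈
  ... | _ , _ , refl = refl

vecWord : {n k : ℕ} → Vec (Fin n) k → List ℕ
vecWord v = map toℕ (vtoList v)

vecWord-injective : {n k : ℕ} {v v′ : Vec (Fin n) k} → vecWord v ≡ vecWord v′ → v ≡ v′
vecWord-injective {v = []ᵥ} {[]ᵥ} _ = refl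
vecWord-injective {v = x ∷ᵥ v} {y ∷ᵥ v′} eq =
  cong₂ _∷ᵥ_ (Fin.toℕ-injective (∷-injectiveˡ eq)) (vecWord-injective (∷-injectiveʳ eq))

vecWord-lookup : {n k : ℕ} (v : Vec (Fin n) k) (h : ℕ → ℕ) → (∀ j → toℕ (lookup v j) ≡ h (toℕ j)) →
  vecWord v ≡ applyUpTo h k
vecWord-lookup []ᵥ h _ = refl
vecWord-lookup (x ∷ᵥ v) h v≗h = cong₂ _∷_ (v≗h fzero) (vecWord-lookup v (h ∘ suc) (v≗h ∘ fsuc))

isPerm : {n : ℕ} → Vec (Fin n) n → Bool
isPerm v = noDupᵇ (vecWord v)

perms-unique : (n : ℕ) → Unique (perms n)
perms-unique n = Unique.filter⁺ (T? ∘ isPerm) (allVecs-unique n n)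

perms⇒IsPermWord : (n : ℕ) {v : Vec (Fin n) n} → v ∈ perms n → IsPermWord n (vecWord v)
perms⇒IsPermWord n {v} v∈ =
  noDupᵇ⇒Unique _ (Equivalence.to T-≡ (proj₂ (∈-filter⁻ (T? ∘ isPerm) {xs = allVecs n n} v∈))) ,
  All.map⁺ (All.tabulate (λ {j} _ → Fin.toℕ<n j)) ,
  trans (length-map toℕ (vtoList v)) (Vec.length-toList v)

wordPerm-∈-perms : (n : ℕ) {w : List ℕ} → w ∈ permWords n → wordPerm n w ∈ perms n
wordPerm-∈-perms n {w} w∈ = ∈-filter⁺ (T? ∘ isPerm) (∈-allVecs n n (wordPerm n w))
  (Equivalence.from T-≡ (trans (cong noDupᵇ word≡) (noDupᵇ-true _ successors-unique)))
  where
  isPW : IsPermWord n w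
  isPW = permWords-sound n w∈
  word≡ : vecWord (wordPerm n w) ≡ applyUpTo (successor w) n
  word≡ = vecWord-lookup (wordPerm n w) (successor w) (toℕ-lookup-wordPerm n isPW)
  successors-unique : Unique (applyUpTo (successor w) n)
  successors-unique = Unique.applyUpTo⁺₁ (successor w) n (λ i<j j<n eq →
    <-irrefl (Successor.successor-injective w (proj₁ isPW)
      (IsPermWord⇒∈ n isPW (<-trans i<j j<n)) (IsPermWord⇒∈ n isPW j<n) eq) i<j)

-- Ψ ∘ wordPerm is the identity on words, so wordPerm is injective; as vecWord injects perms n
-- into the words too, wordPerm maps the words onto perms n.
f≡count-permWords : (k m n : ℕ) → f k m n ≡ count (hasType k m) (permWords n)
f≡count-permWords k m n = begin
  f k m n                               ≡⟨ length-filterᵇ R (perms n) ⟩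
  count R (perms n)                     ≡⟨ count-≡ R (perms-unique n) image-unique perms⊆image image⊆perms ⟩
  count R image                         ≡⟨ count-map R (wordPerm n) (permWords n) ⟩
  count (R ∘ wordPerm n) (permWords n)  ≡⟨ count-cong (permWords n) statistics ⟩
  count (hasType k m) (permWords n)     ∎
  where
  open ≡-Reasoning
  R : Vec (Fin n) n → Bool
  R π = (numCycles π ≡ᵇ m) ∧ (cyclicOcc212 π ≡ᵇ k)
  image : List (Vec (Fin n) n)
  image = map (wordPerm n) (permWords n)
  Ψ∘wordPerm : map Ψ image ≡ permWords n
  Ψ∘wordPerm = trans (sym (map-∘ (permWords n)))
    (trans (List.map-cong-local (All.tabulate (λ w∈ → WordPerm.Ψ-wordPerm n _ (permWords-sound n w∈)))) (List.map-id (permWords n)))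
  image-unique : Unique image
  image-unique = Unique.map⁻ (subst Unique (sym Ψ∘wordPerm) (permWords-unique n))
  image⊆perms : image ⊆ perms n
  image⊆perms π∈ with ∈-map⁻ (wordPerm n) π∈
  ... | _ , w∈ , refl = wordPerm-∈-perms n w∈
  perms≤image : length (perms n) ≤ length image
  perms≤image = subst₂ _≤_ (length-map vecWord (perms n)) (sym (length-map (wordPerm n) (permWords n)))
    (length-⊆ (Unique.map⁺ vecWord-injective (perms-unique n))
      (λ w∈ → let _ , v∈ , w≡ = ∈-map⁻ vecWord w∈ in
        subst (_∈ permWords n) (sym w≡) (permWords-complete n _ (perms⇒IsPermWord n v∈))))
  perms⊆image : perms n ⊆ image
  perms⊆image = ⊆-by-length (Vec.≡-dec Fin._≟_) image-unique image⊆perms perms≤image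
  statistics : ∀ {w} → w ∈ permWords n → R (wordPerm n w) ≡ hasType k m w
  statistics {w} w∈ = cong₂ (λ c o → (c ≡ᵇ m) ∧ (o ≡ᵇ k)) numCycles-wordPerm (cong occ212 Ψ-wordPerm)
    where open WordPerm n w (permWords-sound n w∈)

mainTheorem17 : (n : ℕ) → 3 ≤ n →
    ((m : ℕ) → 1 ≤ m → m ≤ n ∸ 3 → f 1 m n ≡ 2 ^ (n ∸ m ∸ 2))
    × f 1 (n ∸ 1) n ≡ 2
    × f 1 n n ≡ 0
    × f 1 (n ∸ 2) n ≡ 0
mainTheorem17 (suc (suc (suc k))) (s≤s (s≤s (s≤s _))) =
  (λ m 1≤m m≤k → trans (f≡count-permWords 1 m (3 + k)) (count-hasType-1-below k m 1≤m m≤k)) ,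
  trans (f≡count-permWords 1 (2 + k) (3 + k)) (count-hasType-1-diagonal 1 k) ,
  trans (f≡count-permWords 1 (3 + k) (3 + k)) (count-hasType-1-diagonal 2 k) ,
  trans (f≡count-permWords 1 (1 + k) (3 + k)) (count-hasType-1-diagonal 0 k)
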